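{- For $n\ge1$ let $a_n$ be the number of integer sequences $e=(e_1,\dots,e_n)$ with $0\le e_i<i$ for all $i\in[n]$ such that there are no indices $i<j<k$ with $e_i\ne e_j$, $e_j<e_k$ and $e_i\le e_k$. Then $a_1=1$, $a_2=2$, $a_3=5$, and $a_n=3a_{n-1}-2a_{n-2}+a_{n-3}$ for $n\ge 4$. -}

module Defs where

open import Data.Nat using (ℕ; zero; suc; _≤_; _<_)
open import Data.Fin using (Fin; toℕ)
open import Data.Product using (Σ; _×_)
open import Data.Vec using (Vec; lookup)
open import Data.List using (List; length)
open import Data.List.Membership.Propositional using (_∈_)
open import Data.List.Relation.Unary.Unique.Propositional using (Unique)
open import Relation.Binary.PropositionalEquality using (_≢_)
open import Relation.Nullary using (¬_)
open import Function.Bundles using (_⇔_)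

-- A sequence e = (e_1, …, e_n) is stored as a vector e of length n, 0-indexed:
-- position i : Fin n corresponds to the paper's index i+1.
-- Inversion sequence condition 0 ≤ e_{i+1} < i+1, i.e. e[i] ≤ i.
IsInvSeq : ∀ {n} → Vec ℕ n → Set
IsInvSeq {n} e = (i : Fin n) → lookup e i ≤ toℕ i

HasPattern : ∀ {n} → Vec ℕ n → Set
HasPattern {n} e =
  Σ (Fin n) λ i → Σ (Fin n) λ j → Σ (Fin n) λ k →
    (toℕ i < toℕ j) × (toℕ j < toℕ k) ×
    (lookup e i ≢ lookup e j) × (lookup e j < lookup e k) × (lookup e i ≤ lookup e k)

Counted : ∀ {n} → Vec ℕ n → Set
Counted e = IsInvSeq e × ¬ HasPattern e

NumberOf : (n : ℕ) → (Vec ℕ n → Set) → ℕ → Set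
NumberOf n P m = Σ (List (Vec ℕ n)) λ L →
  Unique L × ((e : Vec ℕ n) → (e ∈ L) ⇔ P e) × (length L ≡ m)
  where open import Relation.Binary.PropositionalEquality using (_≡_)

-- Every counted sequence starts with 0; write it as 0 ∷ x. The map raise (0 ↦ 0, v ↦ v + 1 for
-- v ≥ 1) preserves and reflects the pattern and frees the value 1. If 1 does not occur in x, then
-- x = raise u for a counted u. Otherwise x = raise u ++ 1 ∷ b: every entry of b is at most 1 (an
-- entry z > 1 gives the pattern 0, 1, z) and b has no ascent (an ascent 0 < 1 gives the pattern
-- 1, 0, 1), so b = 1ʳ 0ˢ. Conversely all these sequences are counted. Hence
-- a(n+1) = a(n) + k(n), where k(n) counts the lists raise u ++ 1 ∷ 1ʳ 0ˢ of length n. Removing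
-- the last entry gives k(n+1) = k(n) + c(n+1) and c(n+1) = c(n) + a(n), where c counts those with
-- s = 0; eliminating k and c yields the recurrence.

module Submission where

open import Defs
open import Data.Empty using (⊥; ⊥-elim)
open import Data.Fin using (toℕ; zero; suc)
open import Data.Integer using (+_; _+_; _-_; _*_)
open import Data.Integer.Properties using (pos-+; pos-*)
import Data.Integer.Solver as ℤ
open import Data.List using (List; []; _∷_; _++_; _∷ʳ_; [_]; map; length; replicate)
open import Data.List.Properties
  using (++-assoc; ++-identityʳ; length-++; length-map; map-∘; map-id-local;
         map-injective; ∷-injectiveʳ; ∷ʳ-injectiveˡ; ∷ʳ-injectiveʳ)
open import Data.List.Membership.Propositional using (_∈_; _∉_)
open import Data.List.Membership.Propositional.Properties using (∈-map⁺; ∈-map⁻)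
open import Data.List.Relation.Unary.All as All using (All; []; _∷_)
open import Data.List.Relation.Unary.All.Properties using (All¬⇒¬Any; ¬Any⇒All¬; ++⁺; replicate⁺)
open import Data.List.Relation.Unary.AllPairs using ([]; _∷_)
open import Data.List.Relation.Unary.Any as Any using (Any; here; there)
import Data.List.Relation.Unary.Any.Properties as Any
import Data.List.Relation.Unary.First as First
import Data.List.Relation.Unary.First.Properties as First
open import Data.List.Relation.Unary.Unique.Propositional using (Unique)
import Data.List.Relation.Unary.Unique.Propositional.Properties as Unique
open import Data.Nat as ℕ using (ℕ; zero; suc; pred; _≤_; _<_; _∸_; z≤n; s≤s; _≟_)
import Data.Nat.Solver as ℕ
open import Data.Nat.Properties using (≤-trans; ≤⇒≯; ≮⇒≥; n≤1+n; +-comm; +-suc; +-identityʳ)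
open import Data.Product using (Σ; ∃; ∃₂; _×_; _,_; proj₁; proj₂)
import Data.Product as Product
open import Data.Sum using (_⊎_; inj₁; inj₂; [_,_]′; swap)
import Data.Sum as Sum
open import Data.Unit using (⊤; tt)
open import Data.Vec using (Vec; []; _∷_; lookup; toList)
open import Data.Vec.Properties using (length-toList)
open import Function using (_∘_; id)
open import Function.Bundles using (_⇔_; mk⇔; Equivalence)
open import Function.Definitions using (Injective)
open import Relation.Binary.PropositionalEquality
  using (_≡_; _≢_; refl; sym; trans; cong; cong₂; subst; module ≡-Reasoning)
open import Relation.Nullary using (¬_)
open import Relation.Nullary.Decidable using (toSum)

-- Counting lists of a given length

NumberOfLists : {A : Set} → ℕ → (List A → Set) → ℕ → Set
NumberOfLists {A} n P m = Σ (List (List A)) λ L →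
  Unique L × ((w : List A) → (w ∈ L) ⇔ (P w × length w ≡ n)) × length L ≡ m

Image : {A B : Set} → (A → B) → (A → Set) → B → Set
Image f P y = ∃ λ x → P x × y ≡ f x

length-∷ʳ : {A : Set} (xs : List A) (x : A) → length (xs ∷ʳ x) ≡ suc (length xs)
length-∷ʳ xs x = trans (length-++ xs) (+-comm (length xs) 1)

module _ {A : Set} {P : List A → Set} where

  numberOfLists-[] : P [] → NumberOfLists 0 P 1
  numberOfLists-[] p = [ [] ] , [] ∷ [] , (λ w → mk⇔ to from) , refl
    where
    to : ∀ {w} → w ∈ [ [] ] → P w × length w ≡ 0
    to (here refl) = p , refl
    from : ∀ {w} → P w × length w ≡ 0 → w ∈ [ [] ]
    from {[]} _ = here refl

  numberOfLists-none : ¬ P [] → NumberOfLists 0 P 0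
  numberOfLists-none ¬p = [] , [] , (λ w → mk⇔ (λ ()) from) , refl
    where
    from : ∀ {w} → P w × length w ≡ 0 → w ∈ []
    from {[]} (p , _) = ⊥-elim (¬p p)

  numberOfLists-cong : ∀ {Q : List A → Set} {n m} → (∀ {w} → length w ≡ n → Q w ⇔ P w) →
                       NumberOfLists n P m → NumberOfLists n Q m
  numberOfLists-cong {Q} {n} Q⇔P (L , L! , L⇔ , |L|) = L , L! , (λ w → mk⇔ (to w) (from w)) , |L|
    where
    to : ∀ w → w ∈ L → Q w × length w ≡ n
    to w w∈L with Equivalence.to (L⇔ w) w∈L
    ... | p , len = Equivalence.from (Q⇔P len) p , len
    from : ∀ w → Q w × length w ≡ n → w ∈ L
    from w (q , len) = Equivalence.from (L⇔ w) (Equivalence.to (Q⇔P len) q , len)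

  numberOfLists-⊎ : ∀ {Q : List A → Set} {n m k} → NumberOfLists n P m → NumberOfLists n Q k →
                    (∀ {w} → P w → Q w → ⊥) → NumberOfLists n (λ w → P w ⊎ Q w) (m ℕ.+ k)
  numberOfLists-⊎ {Q} {n} (L₁ , L₁! , L₁⇔ , |L₁|) (L₂ , L₂! , L₂⇔ , |L₂|) disjoint =
    L₁ ++ L₂ ,
    Unique.++⁺ L₁! L₂! (λ (w∈L₁ , w∈L₂) →
      disjoint (proj₁ (Equivalence.to (L₁⇔ _) w∈L₁)) (proj₁ (Equivalence.to (L₂⇔ _) w∈L₂))) ,
    (λ w → mk⇔ (to w ∘ Any.++⁻ L₁) (from w)) ,
    trans (length-++ L₁) (cong₂ ℕ._+_ |L₁| |L₂|)
    where
    to : ∀ w → w ∈ L₁ ⊎ w ∈ L₂ → (P w ⊎ Q w) × length w ≡ n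
    to w (inj₁ w∈L₁) = Product.map₁ inj₁ (Equivalence.to (L₁⇔ w) w∈L₁)
    to w (inj₂ w∈L₂) = Product.map₁ inj₂ (Equivalence.to (L₂⇔ w) w∈L₂)
    from : ∀ w → (P w ⊎ Q w) × length w ≡ n → w ∈ L₁ ++ L₂
    from w (inj₁ p , len) = Any.++⁺ˡ (Equivalence.from (L₁⇔ w) (p , len))
    from w (inj₂ q , len) = Any.++⁺ʳ L₁ (Equivalence.from (L₂⇔ w) (q , len))

module _ {A B : Set} {P : List A → Set} (f : List A → List B) (f-injective : Injective _≡_ _≡_ f)
         (length-f : ∀ xs → length (f xs) ≡ suc (length xs)) where

  numberOfLists-image : ∀ {n m} → NumberOfLists n P m → NumberOfLists (suc n) (Image f P) m
  numberOfLists-image {n} (L , L! , L⇔ , |L|) =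
    map f L , Unique.map⁺ f-injective L! , (λ y → mk⇔ (to y) (from y)) , trans (length-map f L) |L|
    where
    to : ∀ y → y ∈ map f L → Image f P y × length y ≡ suc n
    to y y∈ with ∈-map⁻ f y∈
    ... | x , x∈L , refl with Equivalence.to (L⇔ x) x∈L
    ... | p , len = (x , p , refl) , trans (length-f x) (cong suc len)
    from : ∀ y → Image f P y × length y ≡ suc n → y ∈ map f L
    from _ ((x , p , refl) , len) =
      ∈-map⁺ f (Equivalence.from (L⇔ x) (p , cong pred (trans (sym (length-f x)) len)))

-- Pairs and triples of entries in increasing positions

module _ {A : Set} where

  data AnyPair (R : A → A → Set) : List A → Set where
    here  : ∀ {x xs} → Any (R x) xs → AnyPair R (x ∷ xs)
    there : ∀ {x xs} → AnyPair R xs → AnyPair R (x ∷ xs)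

  data AnyTriple (T : A → A → A → Set) : List A → Set where
    here  : ∀ {x xs} → AnyPair (T x) xs → AnyTriple T (x ∷ xs)
    there : ∀ {x xs} → AnyTriple T xs → AnyTriple T (x ∷ xs)

  module _ {R S : A → A → Set} where

    anyPair-map : (∀ {x y} → R x y → S x y) → ∀ {xs} → AnyPair R xs → AnyPair S xs
    anyPair-map f (here r)  = here (Any.map f r)
    anyPair-map f (there p) = there (anyPair-map f p)

    anyPair-mapWithAll : {P : A → Set} → (∀ {x y} → P y → R x y → S x y) →
                         ∀ {xs} → All P xs → AnyPair R xs → AnyPair S xs
    anyPair-mapWithAll f (_ ∷ Pxs) (here r)  = here (any-mapWithAll Pxs r)
      where
      any-mapWithAll : ∀ {x ys} → All _ ys → Any (R x) ys → Any (S x) ys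
      any-mapWithAll (Py ∷ _)  (here r)  = here (f Py r)
      any-mapWithAll (_ ∷ Pys) (there r) = there (any-mapWithAll Pys r)
    anyPair-mapWithAll f (_ ∷ Pxs) (there p) = there (anyPair-mapWithAll f Pxs p)

  module _ {R : A → A → Set} where

    anyPair⇒any : ∀ {xs} → AnyPair R xs → Any (λ x → ∃ (R x)) xs
    anyPair⇒any (here r)  = here (Any.satisfied r)
    anyPair⇒any (there p) = there (anyPair⇒any p)

    anyPair-++⁺ʳ : ∀ xs {ys} → AnyPair R ys → AnyPair R (xs ++ ys)
    anyPair-++⁺ʳ []       p = p
    anyPair-++⁺ʳ (x ∷ xs) p = there (anyPair-++⁺ʳ xs p)

    anyPair-++⁻ : ∀ xs {ys} → AnyPair R (xs ++ ys) →
                  AnyPair R xs ⊎ AnyPair R ys ⊎ Any (λ x → Any (R x) ys) xs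
    anyPair-++⁻ []       p         = inj₂ (inj₁ p)
    anyPair-++⁻ (x ∷ xs) (here r)  = [ inj₁ ∘ here , inj₂ ∘ inj₂ ∘ here ]′ (Any.++⁻ xs r)
    anyPair-++⁻ (x ∷ xs) (there p) = Sum.map there (Sum.map₂ there) (anyPair-++⁻ xs p)

  anyTriple-map : ∀ {T U : A → A → A → Set} → (∀ {x y z} → T x y z → U x y z) →
                  ∀ {xs} → AnyTriple T xs → AnyTriple U xs
  anyTriple-map f (here p)  = here (anyPair-map f p)
  anyTriple-map f (there t) = there (anyTriple-map f t)

  module _ {T : A → A → A → Set} where

    anyTriple⇒anyPair : ∀ {xs} → AnyTriple T xs → AnyPair (λ y z → ∃ λ x → T x y z) xs
    anyTriple⇒anyPair (here p)  = there (anyPair-map (_ ,_) p)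
    anyTriple⇒anyPair (there t) = there (anyTriple⇒anyPair t)

    anyTriple-++⁺ˡ : ∀ {xs ys} → AnyTriple T xs → AnyTriple T (xs ++ ys)
    anyTriple-++⁺ˡ (here p)  = here (anyPair-++⁺ˡ p)
      where
      anyPair-++⁺ˡ : ∀ {R : A → A → Set} {xs ys} → AnyPair R xs → AnyPair R (xs ++ ys)
      anyPair-++⁺ˡ (here r)  = here (Any.++⁺ˡ r)
      anyPair-++⁺ˡ (there p) = there (anyPair-++⁺ˡ p)
    anyTriple-++⁺ˡ (there t) = there (anyTriple-++⁺ˡ t)

    anyTriple-++⁺ʳ : ∀ xs {ys} → AnyTriple T ys → AnyTriple T (xs ++ ys)
    anyTriple-++⁺ʳ []       t = t
    anyTriple-++⁺ʳ (x ∷ xs) t = there (anyTriple-++⁺ʳ xs t)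

    anyTriple-++⁻ : ∀ xs {ys} → AnyTriple T (xs ++ ys) →
                    AnyTriple T xs ⊎ AnyTriple T ys ⊎
                    Any (λ x → AnyPair (T x) ys) xs ⊎ AnyPair (λ x y → Any (T x y) ys) xs
    anyTriple-++⁻ []       t = inj₂ (inj₁ t)
    anyTriple-++⁻ (x ∷ xs) (here p) with anyPair-++⁻ xs p
    ... | inj₁ p′         = inj₁ (here p′)
    ... | inj₂ (inj₁ p′)  = inj₂ (inj₂ (inj₁ (here p′)))
    ... | inj₂ (inj₂ any) = inj₂ (inj₂ (inj₂ (here any)))
    anyTriple-++⁻ (x ∷ xs) (there t) =
      Sum.map there (Sum.map₂ (Sum.map there there)) (anyTriple-++⁻ xs t)

module _ {A B : Set} (f : A → B) where

  anyPair-map⁺ : ∀ {R : B → B → Set} {xs} → AnyPair (λ x y → R (f x) (f y)) xs → AnyPair R (map f xs)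
  anyPair-map⁺ (here r)  = here (Any.map⁺ r)
  anyPair-map⁺ (there p) = there (anyPair-map⁺ p)

  anyPair-map⁻ : ∀ {R : B → B → Set} {xs} → AnyPair R (map f xs) → AnyPair (λ x y → R (f x) (f y)) xs
  anyPair-map⁻ {xs = _ ∷ _} (here r)  = here (Any.map⁻ r)
  anyPair-map⁻ {xs = _ ∷ _} (there p) = there (anyPair-map⁻ p)

  anyTriple-map⁺ : ∀ {T : B → B → B → Set} {xs} →
                   AnyTriple (λ x y z → T (f x) (f y) (f z)) xs → AnyTriple T (map f xs)
  anyTriple-map⁺ (here p)  = here (anyPair-map⁺ p)
  anyTriple-map⁺ (there t) = there (anyTriple-map⁺ t)

  anyTriple-map⁻ : ∀ {T : B → B → B → Set} {xs} →
                   AnyTriple T (map f xs) → AnyTriple (λ x y z → T (f x) (f y) (f z)) xs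
  anyTriple-map⁻ {xs = _ ∷ _} (here p)  = here (anyPair-map⁻ p)
  anyTriple-map⁻ {xs = _ ∷ _} (there t) = there (anyTriple-map⁻ t)

-- The pattern and inversion sequences, for lists

Forbidden : ℕ → ℕ → ℕ → Set
Forbidden x y z = x ≢ y × y < z × x ≤ z

Pattern : List ℕ → Set
Pattern = AnyTriple Forbidden

InversionFrom : ℕ → List ℕ → Set
InversionFrom s []       = ⊤
InversionFrom s (x ∷ xs) = x ≤ s × InversionFrom (suc s) xs

Good : List ℕ → Set
Good w = InversionFrom 0 w × ¬ Pattern w

inversionFrom-mono : ∀ {s t} xs → s ≤ t → InversionFrom s xs → InversionFrom t xs
inversionFrom-mono []       _   _           = tt
inversionFrom-mono (x ∷ xs) s≤t (x≤s , inv) = ≤-trans x≤s s≤t , inversionFrom-mono xs (s≤s s≤t) inv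

inversionFrom-++⁺ : ∀ {s} xs {ys} → InversionFrom s xs → InversionFrom s ys → InversionFrom s (xs ++ ys)
inversionFrom-++⁺ []       _            inv = inv
inversionFrom-++⁺ (x ∷ xs) (x≤s , invx) inv =
  x≤s , inversionFrom-++⁺ xs invx (inversionFrom-mono _ (n≤1+n _) inv)

inversionFrom-++⁻ˡ : ∀ {s} xs {ys} → InversionFrom s (xs ++ ys) → InversionFrom s xs
inversionFrom-++⁻ˡ []       _           = tt
inversionFrom-++⁻ˡ (x ∷ xs) (x≤s , inv) = x≤s , inversionFrom-++⁻ˡ xs inv

inversionFrom-bounded : ∀ {s xs} → All (_≤ s) xs → InversionFrom s xs
inversionFrom-bounded []           = tt
inversionFrom-bounded (x≤s ∷ xs≤s) = x≤s , inversionFrom-mono _ (n≤1+n _) (inversionFrom-bounded xs≤s)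

inversionFrom-pred : ∀ {s} xs → InversionFrom (suc s) xs → InversionFrom s (map pred xs)
inversionFrom-pred []           _               = tt
inversionFrom-pred (zero ∷ xs)  (_ , inv)       = z≤n , inversionFrom-pred xs inv
inversionFrom-pred (suc x ∷ xs) (s≤s x≤s , inv) = x≤s , inversionFrom-pred xs inv

raise : ℕ → ℕ
raise zero    = zero
raise (suc v) = suc (suc v)

raise-injective : Injective _≡_ _≡_ raise
raise-injective {zero}  {zero}  _    = refl
raise-injective {suc x} {suc y} refl = refl

raise≢1 : ∀ x → raise x ≢ 1
raise≢1 zero    ()
raise≢1 (suc x) ()

raise-pred : ∀ {x} → x ≢ 1 → raise (pred x) ≡ x
raise-pred {zero}        _   = refl
raise-pred {suc zero}    x≢1 = ⊥-elim (x≢1 refl)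
raise-pred {suc (suc x)} _   = refl

map-raise-pred : ∀ {xs} → All (_≢ 1) xs → map raise (map pred xs) ≡ xs
map-raise-pred {xs} xs≢1 = trans (sym (map-∘ xs)) (map-id-local (All.map raise-pred xs≢1))

1∉map-raise : ∀ xs → 1 ∉ map raise xs
1∉map-raise xs 1∈ with ∈-map⁻ raise 1∈
... | x , _ , 1≡raise-x = raise≢1 x (sym 1≡raise-x)

inversionFrom-raise : ∀ {s} xs → InversionFrom s xs → InversionFrom (suc s) (map raise xs)
inversionFrom-raise []           _           = tt
inversionFrom-raise (zero ∷ xs)  (_ , inv)   = z≤n , inversionFrom-raise xs inv
inversionFrom-raise (suc x ∷ xs) (x≤s , inv) = s≤s x≤s , inversionFrom-raise xs inv

raise-mono-≤ : ∀ {x y} → x ≤ y → raise x ≤ raise y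
raise-mono-≤ {zero}          _         = z≤n
raise-mono-≤ {suc x} {suc y} (s≤s x≤y) = s≤s (s≤s x≤y)

raise-cancel-≤ : ∀ {x y} → raise x ≤ raise y → x ≤ y
raise-cancel-≤ {zero}          _               = z≤n
raise-cancel-≤ {suc x} {suc y} (s≤s (s≤s x≤y)) = s≤s x≤y

raise-mono-< : ∀ {x y} → x < y → raise x < raise y
raise-mono-< {zero}  {suc y} _         = s≤s z≤n
raise-mono-< {suc x} {suc y} (s≤s x<y) = s≤s (s≤s x<y)

raise-cancel-< : ∀ {x y} → raise x < raise y → x < y
raise-cancel-< {zero}  {suc y} _               = s≤s z≤n
raise-cancel-< {suc x} {suc y} (s≤s (s≤s x<y)) = s≤s x<y

pattern-raise⁺ : ∀ {xs} → Pattern xs → Pattern (map raise xs)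
pattern-raise⁺ = anyTriple-map⁺ raise ∘ anyTriple-map forbidden
  where
  forbidden : ∀ {x y z} → Forbidden x y z → Forbidden (raise x) (raise y) (raise z)
  forbidden (x≢y , y<z , x≤z) = x≢y ∘ raise-injective , raise-mono-< y<z , raise-mono-≤ x≤z

pattern-raise⁻ : ∀ {xs} → Pattern (map raise xs) → Pattern xs
pattern-raise⁻ = anyTriple-map forbidden ∘ anyTriple-map⁻ raise
  where
  forbidden : ∀ {x y z} → Forbidden (raise x) (raise y) (raise z) → Forbidden x y z
  forbidden (x≢y , y<z , x≤z) = x≢y ∘ cong raise , raise-cancel-< y<z , raise-cancel-≤ x≤z

onesZeros : ℕ → ℕ → List ℕ
onesZeros r s = replicate r 1 ++ replicate s 0

onesZeros-≤1 : ∀ r s → All (_≤ 1) (onesZeros r s)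
onesZeros-≤1 r s = ++⁺ (replicate⁺ r (s≤s z≤n)) (replicate⁺ s z≤n)

onesZeros-noAscent : ∀ r s → ¬ AnyPair _<_ (onesZeros r s)
onesZeros-noAscent (suc r) s    (here 1<z) = All¬⇒¬Any (All.map ≤⇒≯ (onesZeros-≤1 r s)) 1<z
onesZeros-noAscent (suc r) s    (there p)  = onesZeros-noAscent r s p
onesZeros-noAscent zero (suc s) (here 0<z) = All¬⇒¬Any (replicate⁺ s λ ()) 0<z
onesZeros-noAscent zero (suc s) (there p)  = onesZeros-noAscent zero s p

noAscent⇒onesZeros : ∀ {xs} → All (_≤ 1) xs → ¬ AnyPair _<_ xs → ∃₂ λ r s → xs ≡ onesZeros r s
noAscent⇒onesZeros [] _ = 0 , 0 , refl
noAscent⇒onesZeros {zero ∷ xs} (_ ∷ xs≤1) noAscent with noAscent⇒onesZeros xs≤1 (noAscent ∘ there)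
... | zero  , s , refl = 0 , suc s , refl
... | suc r , s , refl = ⊥-elim (noAscent (here (here (s≤s z≤n))))
noAscent⇒onesZeros {suc zero ∷ xs} (_ ∷ xs≤1) noAscent with noAscent⇒onesZeros xs≤1 (noAscent ∘ there)
... | r , s , refl = suc r , s , refl
noAscent⇒onesZeros {suc (suc _) ∷ _} (s≤s () ∷ _) _

replicate-suc : ∀ {A : Set} n (x : A) → replicate (suc n) x ≡ replicate n x ∷ʳ x
replicate-suc zero    x = refl
replicate-suc (suc n) x = cong (x ∷_) (replicate-suc n x)

onesZeros-suc : ∀ r s → onesZeros r (suc s) ≡ onesZeros r s ∷ʳ 0
onesZeros-suc r s = trans (cong (replicate r 1 ++_) (replicate-suc s 0)) (sym (++-assoc (replicate r 1) _ _))

-- Structure of good lists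

forbidden-≤1 : ∀ {x y z} → z ≤ 1 → Forbidden x y z → x ≡ 1
forbidden-≤1 {_}           {_}     {zero}        _        (_ , () , _)
forbidden-≤1 {zero}        {zero}  {suc zero}    _        (x≢y , _)       = ⊥-elim (x≢y refl)
forbidden-≤1 {zero}        {suc _} {suc zero}    _        (_ , s≤s () , _)
forbidden-≤1 {suc zero}    {_}     {suc zero}    _        _               = refl
forbidden-≤1 {suc (suc _)} {_}     {suc zero}    _        (_ , _ , s≤s ())
forbidden-≤1 {_}           {_}     {suc (suc _)} (s≤s ()) _

ascent⇒forbidden-1 : ∀ {y z} → z ≤ 1 → y < z → Forbidden 1 y z
ascent⇒forbidden-1 {zero}  {suc zero}    _        _         = (λ ()) , s≤s z≤n , s≤s z≤n
ascent⇒forbidden-1 {suc _} {suc zero}    _        (s≤s ())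
ascent⇒forbidden-1 {_}     {suc (suc _)} (s≤s ()) _

¬pattern-raise-++-onesZeros : ∀ {xs} r s → ¬ Pattern xs → ¬ Pattern (map raise xs ++ onesZeros r s)
¬pattern-raise-++-onesZeros {xs} r s free p with anyTriple-++⁻ (map raise xs) p
... | inj₁ p′ = free (pattern-raise⁻ p′)
... | inj₂ (inj₁ p′) =
  onesZeros-noAscent r s (anyPair-map (proj₁ ∘ proj₂ ∘ proj₂) (anyTriple⇒anyPair p′))
... | inj₂ (inj₂ (inj₁ any)) =
  onesZeros-noAscent r s (anyPair-map (proj₁ ∘ proj₂) (proj₂ (Any.satisfied any)))
... | inj₂ (inj₂ (inj₂ q)) = 1∉map-raise xs (Any.map (sym ∘ first≡1) (anyPair⇒any q))
  where
  first≡1 : ∀ {x} → ∃ (λ y → Any (Forbidden x y) (onesZeros r s)) → x ≡ 1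
  first≡1 (_ , any) = All.lookupWith forbidden-≤1 (onesZeros-≤1 r s) any

-- A good list starts with 0, so a pattern starting at the new 0 also starts at the old one.
good⇒¬pattern-0∷ : ∀ {xs} → Good xs → ¬ Pattern (0 ∷ xs)
good⇒¬pattern-0∷ (_ , free)                 (there p)         = free p
good⇒¬pattern-0∷ {_ ∷ _} ((z≤n , _) , _)    (here (here any)) = proj₁ (proj₂ (Any.satisfied any)) refl
good⇒¬pattern-0∷ {_ ∷ _} ((z≤n , _) , free) (here (there p))  = free (here p)

good-0∷raise-++-onesZeros : ∀ {u} → Good u → ∀ r s → Good (0 ∷ map raise u ++ onesZeros r s)
good-0∷raise-++-onesZeros {u} good@(inv , _) r s =
  (z≤n , inversionFrom-++⁺ (map raise u) (inversionFrom-raise u inv)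
                           (inversionFrom-bounded (onesZeros-≤1 r s))) ,
  ¬pattern-raise-++-onesZeros {0 ∷ u} r s (good⇒¬pattern-0∷ good)

good-map-pred : ∀ {xs} → All (_≢ 1) xs → InversionFrom 1 xs → ¬ Pattern xs → Good (map pred xs)
good-map-pred {xs} xs≢1 inv free =
  inversionFrom-pred xs inv , free ∘ subst Pattern (map-raise-pred xs≢1) ∘ pattern-raise⁺

RaisedOnesZeros : List ℕ → Set
RaisedOnesZeros w = ∃ λ u → Good u × ∃₂ λ r s → w ≡ map raise u ++ 1 ∷ onesZeros r s

¬pattern⇒onesZeros-after-1 : ∀ ys {zs} → ¬ Pattern (0 ∷ ys ++ 1 ∷ zs) → ∃₂ λ r s → zs ≡ onesZeros r s
¬pattern⇒onesZeros-after-1 ys {zs} free = noAscent⇒onesZeros zs≤1 noAscent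
  where
  zs≤1 : All (_≤ 1) zs
  zs≤1 = All.map ≮⇒≥ (¬Any⇒All¬ zs λ 1<z →
    free (here (anyPair-++⁺ʳ ys (here (Any.map (λ 1<z → (λ ()) , 1<z , z≤n) 1<z)))))
  noAscent : ¬ AnyPair _<_ zs
  noAscent asc = free (there (anyTriple-++⁺ʳ ys (here (anyPair-mapWithAll ascent⇒forbidden-1 zs≤1 asc))))

good-0∷⇒ : ∀ {xs} → Good (0 ∷ xs) → Image (map raise) Good xs ⊎ RaisedOnesZeros xs
good-0∷⇒ {xs} ((_ , inv) , free) with First.first (λ x → swap (toSum (x ≟ 1))) xs
... | inj₂ xs≢1 = inj₁ (map pred xs , good-map-pred xs≢1 inv (free ∘ there) , sym (map-raise-pred xs≢1))
... | inj₁ first with First.toView first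
... | First._++_∷_ {ys} ys≢1 refl zs with ¬pattern⇒onesZeros-after-1 ys free
... | r , s , refl =
  inj₂ (map pred ys , good-map-pred ys≢1 (inversionFrom-++⁻ˡ ys inv) (free ∘ there ∘ anyTriple-++⁺ˡ) ,
        r , s , cong (λ t → t ++ 1 ∷ onesZeros r s) (sym (map-raise-pred ys≢1)))

-- Counting good lists

RaisedOnes : List ℕ → Set
RaisedOnes w = ∃ λ u → Good u × ∃ λ r → w ≡ map raise u ++ 1 ∷ replicate r 1

good-∷⇔ : ∀ {x xs} →
          Good (x ∷ xs) ⇔
          (Image (λ u → 0 ∷ map raise u) Good (x ∷ xs) ⊎ Image (0 ∷_) RaisedOnesZeros (x ∷ xs))
good-∷⇔ = mk⇔ to from
  where
  to : ∀ {x xs} → Good (x ∷ xs) →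
       Image (λ u → 0 ∷ map raise u) Good (x ∷ xs) ⊎ Image (0 ∷_) RaisedOnesZeros (x ∷ xs)
  to good@((z≤n , _) , _) with good-0∷⇒ good
  ... | inj₁ (u , good-u , refl) = inj₁ (u , good-u , refl)
  ... | inj₂ raised             = inj₂ (_ , raised , refl)
  from : ∀ {w} → Image (λ u → 0 ∷ map raise u) Good w ⊎ Image (0 ∷_) RaisedOnesZeros w → Good w
  from (inj₁ (u , good-u , refl)) =
    subst (Good ∘ (0 ∷_)) (++-identityʳ (map raise u)) (good-0∷raise-++-onesZeros good-u 0 0)
  from (inj₂ (_ , (u , good-u , r , s , refl) , refl)) = good-0∷raise-++-onesZeros good-u (suc r) s

raisedOnesZeros⇔ : ∀ {w} → RaisedOnesZeros w ⇔ (Image (_∷ʳ 0) RaisedOnesZeros w ⊎ RaisedOnes w)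
raisedOnesZeros⇔ = mk⇔ to from
  where
  to : ∀ {w} → RaisedOnesZeros w → Image (_∷ʳ 0) RaisedOnesZeros w ⊎ RaisedOnes w
  to (u , good-u , r , zero , refl) =
    inj₂ (u , good-u , r , cong (λ t → map raise u ++ 1 ∷ t) (++-identityʳ (replicate r 1)))
  to (u , good-u , r , suc s , refl) =
    inj₁ (_ , (u , good-u , r , s , refl) ,
          trans (cong (λ t → map raise u ++ 1 ∷ t) (onesZeros-suc r s)) (sym (++-assoc (map raise u) _ _)))
  from : ∀ {w} → Image (_∷ʳ 0) RaisedOnesZeros w ⊎ RaisedOnes w → RaisedOnesZeros w
  from (inj₁ (_ , (u , good-u , r , s , refl) , refl)) =
    u , good-u , r , suc s ,
    trans (++-assoc (map raise u) _ _) (cong (λ t → map raise u ++ 1 ∷ t) (sym (onesZeros-suc r s)))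
  from (inj₂ (u , good-u , r , refl)) =
    u , good-u , r , 0 , cong (λ t → map raise u ++ 1 ∷ t) (sym (++-identityʳ (replicate r 1)))

raisedOnes⇔ : ∀ {w} →
              RaisedOnes w ⇔ (Image (_∷ʳ 1) RaisedOnes w ⊎ Image (λ u → map raise u ∷ʳ 1) Good w)
raisedOnes⇔ = mk⇔ to from
  where
  to : ∀ {w} → RaisedOnes w → Image (_∷ʳ 1) RaisedOnes w ⊎ Image (λ u → map raise u ∷ʳ 1) Good w
  to (u , good-u , zero , refl) = inj₂ (u , good-u , refl)
  to (u , good-u , suc r , refl) =
    inj₁ (_ , (u , good-u , r , refl) ,
          trans (cong (λ t → map raise u ++ 1 ∷ t) (replicate-suc r 1)) (sym (++-assoc (map raise u) _ _)))
  from : ∀ {w} → Image (_∷ʳ 1) RaisedOnes w ⊎ Image (λ u → map raise u ∷ʳ 1) Good w → RaisedOnes w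
  from (inj₁ (_ , (u , good-u , r , refl) , refl)) =
    u , good-u , suc r ,
    trans (++-assoc (map raise u) _ _) (cong (λ t → map raise u ++ 1 ∷ t) (sym (replicate-suc r 1)))
  from (inj₂ (u , good-u , refl)) = u , good-u , 0 , refl

1∈raisedOnesZeros : ∀ {w} → RaisedOnesZeros w → 1 ∈ w
1∈raisedOnesZeros (u , _ , _ , _ , refl) = Any.++⁺ʳ (map raise u) (here refl)

1∈raisedOnes : ∀ {w} → RaisedOnes w → 1 ∈ w
1∈raisedOnes (u , _ , _ , refl) = Any.++⁺ʳ (map raise u) (here refl)

raisedOnes-∷ʳ1 : ∀ {w} → RaisedOnes w → ∃ λ y → w ≡ y ∷ʳ 1
raisedOnes-∷ʳ1 ro with Equivalence.to raisedOnes⇔ ro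
... | inj₁ (y , _ , eq) = y , eq
... | inj₂ (u , _ , eq) = map raise u , eq

++-∷≢[] : ∀ {A : Set} (xs : List A) {y ys} → xs ++ y ∷ ys ≢ []
++-∷≢[] []      ()
++-∷≢[] (_ ∷ _) ()

map-raise-injective : Injective _≡_ _≡_ (map raise)
map-raise-injective = map-injective raise-injective

#Good #RaisedOnesZeros #RaisedOnes : ℕ → ℕ
#Good zero              = 1
#Good (suc n)           = #Good n ℕ.+ #RaisedOnesZeros n
#RaisedOnesZeros zero    = 0
#RaisedOnesZeros (suc n) = #RaisedOnesZeros n ℕ.+ #RaisedOnes (suc n)
#RaisedOnes zero         = 0
#RaisedOnes (suc n)      = #RaisedOnes n ℕ.+ #Good n

numberOfLists-good : ∀ n → NumberOfLists n Good (#Good n)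
numberOfLists-raisedOnesZeros : ∀ n → NumberOfLists n RaisedOnesZeros (#RaisedOnesZeros n)
numberOfLists-raisedOnes : ∀ n → NumberOfLists n RaisedOnes (#RaisedOnes n)

numberOfLists-good zero = numberOfLists-[] (tt , λ ())
numberOfLists-good (suc n) =
  numberOfLists-cong (λ { {[]} () ; {_ ∷ _} _ → good-∷⇔ })
    (numberOfLists-⊎
      (numberOfLists-image (λ u → 0 ∷ map raise u) (map-raise-injective ∘ ∷-injectiveʳ)
        (cong suc ∘ length-map raise) (numberOfLists-good n))
      (numberOfLists-image (0 ∷_) ∷-injectiveʳ (λ _ → refl) (numberOfLists-raisedOnesZeros n))
      disjoint)
  where
  disjoint : ∀ {w} → Image (λ u → 0 ∷ map raise u) Good w → Image (0 ∷_) RaisedOnesZeros w → ⊥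
  disjoint (u , _ , refl) (_ , roz , eq) =
    1∉map-raise u (subst (1 ∈_) (∷-injectiveʳ (sym eq)) (1∈raisedOnesZeros roz))

numberOfLists-raisedOnesZeros zero =
  numberOfLists-none λ (u , _ , _ , _ , eq) → ++-∷≢[] (map raise u) (sym eq)
numberOfLists-raisedOnesZeros (suc n) =
  numberOfLists-cong (λ _ → raisedOnesZeros⇔)
    (numberOfLists-⊎
      (numberOfLists-image (_∷ʳ 0) (∷ʳ-injectiveˡ _ _) (λ xs → length-∷ʳ xs 0)
        (numberOfLists-raisedOnesZeros n))
      (numberOfLists-raisedOnes (suc n))
      disjoint)
  where
  disjoint : ∀ {w} → Image (_∷ʳ 0) RaisedOnesZeros w → RaisedOnes w → ⊥
  disjoint (y , _ , refl) ro with raisedOnes-∷ʳ1 ro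
  ... | y′ , eq with () ← ∷ʳ-injectiveʳ y y′ eq

numberOfLists-raisedOnes zero =
  numberOfLists-none λ (u , _ , _ , eq) → ++-∷≢[] (map raise u) (sym eq)
numberOfLists-raisedOnes (suc n) =
  numberOfLists-cong (λ _ → raisedOnes⇔)
    (numberOfLists-⊎
      (numberOfLists-image (_∷ʳ 1) (∷ʳ-injectiveˡ _ _) (λ xs → length-∷ʳ xs 1)
        (numberOfLists-raisedOnes n))
      (numberOfLists-image (λ u → map raise u ∷ʳ 1) (map-raise-injective ∘ ∷ʳ-injectiveˡ _ _)
        (λ u → trans (length-∷ʳ (map raise u) 1) (cong suc (length-map raise u))) (numberOfLists-good n))
      disjoint)
  where
  disjoint : ∀ {w} → Image (_∷ʳ 1) RaisedOnes w → Image (λ u → map raise u ∷ʳ 1) Good w → ⊥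
  disjoint (y , ro , refl) (u , _ , eq) =
    1∉map-raise u (subst (1 ∈_) (∷ʳ-injectiveˡ y _ eq) (1∈raisedOnes ro))

-- From lists to vectors

-- Pads with zeros; only ever applied to lists of length n, where it inverts toList.
toVec : (n : ℕ) → List ℕ → Vec ℕ n
toVec zero    _        = []
toVec (suc n) []       = 0 ∷ toVec n []
toVec (suc n) (x ∷ xs) = x ∷ toVec n xs

toList-toVec : ∀ {n} xs → length xs ≡ n → toList (toVec n xs) ≡ xs
toList-toVec []       refl = refl
toList-toVec (x ∷ xs) refl = cong (x ∷_) (toList-toVec xs refl)

toVec-toList : ∀ {n} (e : Vec ℕ n) → toVec n (toList e) ≡ e
toVec-toList []      = refl
toVec-toList (x ∷ e) = cong (x ∷_) (toVec-toList e)

numberOf-fromLists : ∀ {n m} {P : List ℕ → Set} {Q : Vec ℕ n → Set} →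
                     (∀ e → Q e ⇔ P (toList e)) → NumberOfLists n P m → NumberOf n Q m
numberOf-fromLists {n} {P = P} {Q} Q⇔P (L , L! , L⇔ , |L|) =
  map (toVec n) L , unique , (λ e → mk⇔ (to e) (from e)) , trans (length-map (toVec n) L) |L|
  where
  toList∘toVec≡id : All (λ w → toList (toVec n w) ≡ w) L
  toList∘toVec≡id = All.tabulate λ {w} w∈L → toList-toVec w (proj₂ (Equivalence.to (L⇔ w) w∈L))
  unique : Unique (map (toVec n) L)
  unique = Unique.map⁻ {f = toList}
    (subst Unique (sym (trans (sym (map-∘ L)) (map-id-local {f = toList ∘ toVec n} toList∘toVec≡id))) L!)
  to : ∀ e → e ∈ map (toVec n) L → Q e
  to e e∈ with ∈-map⁻ (toVec n) e∈
  ... | w , w∈L , refl with Equivalence.to (L⇔ w) w∈L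
  ... | p , len = Equivalence.from (Q⇔P _) (subst P (sym (toList-toVec w len)) p)
  from : ∀ e → Q e → e ∈ map (toVec n) L
  from e q = subst (_∈ map (toVec n) L) (toVec-toList e)
    (∈-map⁺ (toVec n) (Equivalence.from (L⇔ (toList e)) (Equivalence.to (Q⇔P e) q , length-toList e)))

inversionFrom-toList⁺ : ∀ {n} s (e : Vec ℕ n) →
                        (∀ i → lookup e i ≤ s ℕ.+ toℕ i) → InversionFrom s (toList e)
inversionFrom-toList⁺ s []      _     = tt
inversionFrom-toList⁺ s (x ∷ e) bound =
  subst (x ≤_) (+-identityʳ s) (bound zero) ,
  inversionFrom-toList⁺ (suc s) e λ i → subst (lookup e i ≤_) (+-suc s (toℕ i)) (bound (suc i))

inversionFrom-toList⁻ : ∀ {n} s (e : Vec ℕ n) →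
                        InversionFrom s (toList e) → ∀ i → lookup e i ≤ s ℕ.+ toℕ i
inversionFrom-toList⁻ s (x ∷ e) (x≤s , _) zero    = subst (x ≤_) (sym (+-identityʳ s)) x≤s
inversionFrom-toList⁻ s (x ∷ e) (_ , inv) (suc i) =
  subst (lookup e i ≤_) (sym (+-suc s (toℕ i))) (inversionFrom-toList⁻ (suc s) e inv i)

module _ {A : Set} where

  any-toList⁺ : ∀ {P : A → Set} {n} (e : Vec A n) k → P (lookup e k) → Any P (toList e)
  any-toList⁺ (x ∷ e) zero    p = here p
  any-toList⁺ (x ∷ e) (suc k) p = there (any-toList⁺ e k p)

  any-toList⁻ : ∀ {P : A → Set} {n} (e : Vec A n) → Any P (toList e) → ∃ λ k → P (lookup e k)
  any-toList⁻ (x ∷ e) (here p)  = zero , p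
  any-toList⁻ (x ∷ e) (there a) = Product.map suc id (any-toList⁻ e a)

  anyPair-toList⁺ : ∀ {R : A → A → Set} {n} (e : Vec A n) j k → toℕ j < toℕ k →
                    R (lookup e j) (lookup e k) → AnyPair R (toList e)
  anyPair-toList⁺ (x ∷ e) zero    (suc k) _         r = here (any-toList⁺ e k r)
  anyPair-toList⁺ (x ∷ e) (suc j) (suc k) (s≤s j<k) r = there (anyPair-toList⁺ e j k j<k r)

  anyPair-toList⁻ : ∀ {R : A → A → Set} {n} (e : Vec A n) → AnyPair R (toList e) →
                    ∃₂ λ j k → toℕ j < toℕ k × R (lookup e j) (lookup e k)
  anyPair-toList⁻ (x ∷ e) (here a) with any-toList⁻ e a
  ... | k , r = zero , suc k , s≤s z≤n , r
  anyPair-toList⁻ (x ∷ e) (there p) with anyPair-toList⁻ e p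
  ... | j , k , j<k , r = suc j , suc k , s≤s j<k , r

hasPattern⇒pattern : ∀ {n} (e : Vec ℕ n) → HasPattern e → Pattern (toList e)
hasPattern⇒pattern (x ∷ e) (zero , suc j , suc k , _ , s≤s j<k , f) = here (anyPair-toList⁺ e j k j<k f)
hasPattern⇒pattern (x ∷ e) (suc i , suc j , suc k , s≤s i<j , s≤s j<k , f) =
  there (hasPattern⇒pattern e (i , j , k , i<j , j<k , f))

pattern⇒hasPattern : ∀ {n} (e : Vec ℕ n) → Pattern (toList e) → HasPattern e
pattern⇒hasPattern (x ∷ e) (here p) with anyPair-toList⁻ e p
... | j , k , j<k , f = zero , suc j , suc k , s≤s z≤n , s≤s j<k , f
pattern⇒hasPattern (x ∷ e) (there t) with pattern⇒hasPattern e t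
... | i , j , k , i<j , j<k , f = suc i , suc j , suc k , s≤s i<j , s≤s j<k , f

counted⇔good : ∀ {n} (e : Vec ℕ n) → Counted e ⇔ Good (toList e)
counted⇔good e = mk⇔
  (Product.map (inversionFrom-toList⁺ 0 e) (λ ¬p → ¬p ∘ pattern⇒hasPattern e))
  (Product.map (inversionFrom-toList⁻ 0 e) (λ ¬p → ¬p ∘ hasPattern⇒pattern e))

-- Both sides unfold definitionally to polynomials in the three counts at n.
#Good-recurrence : ∀ n → #Good (3 ℕ.+ n) ℕ.+ 2 ℕ.* #Good (1 ℕ.+ n) ≡ 3 ℕ.* #Good (2 ℕ.+ n) ℕ.+ #Good n
#Good-recurrence n = solve 3
  (λ g k c → let g₁ = g :+ k ; c₁ = c :+ g ; k₁ = k :+ c₁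
                 g₂ = g₁ :+ k₁ ; c₂ = c₁ :+ g₁ ; k₂ = k₁ :+ c₂
             in (g₂ :+ k₂) :+ con 2 :* g₁ := con 3 :* g₂ :+ g)
  refl (#Good n) (#RaisedOnesZeros n) (#RaisedOnes n)
  where open ℕ.+-*-Solver

ℕ-identity⇒ℤ-identity : ∀ a b c d p q →
                        a ℕ.+ p ℕ.* b ≡ q ℕ.* c ℕ.+ d → + a ≡ + q * + c - + p * + b + + d
ℕ-identity⇒ℤ-identity a b c d p q eq = begin
  + a                           ≡⟨ solve 2 (λ a pb → a := a :+ pb :- pb) refl (+ a) (+ p * + b) ⟩
  + a + + p * + b - + p * + b   ≡⟨ cong (_- + p * + b) eqℤ ⟩
  + q * + c + + d - + p * + b   ≡⟨ solve 3 (λ qc d pb → qc :+ d :- pb := qc :- pb :+ d) refl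
                                           (+ q * + c) (+ d) (+ p * + b) ⟩
  + q * + c - + p * + b + + d   ∎
  where
  open ℤ.+-*-Solver
  open ≡-Reasoning
  eqℤ : + a + + p * + b ≡ + q * + c + + d
  eqℤ = begin
    + a + + p * + b     ≡⟨ cong (λ t → + a + t) (pos-* p b) ⟨
    + a + + (p ℕ.* b)   ≡⟨ pos-+ a (p ℕ.* b) ⟨
    + (a ℕ.+ p ℕ.* b)   ≡⟨ cong +_ eq ⟩
    + (q ℕ.* c ℕ.+ d)   ≡⟨ pos-+ (q ℕ.* c) d ⟩
    + (q ℕ.* c) + + d   ≡⟨ cong (_+ + d) (pos-* q c) ⟩
    + q * + c + + d     ∎

mainTheorem7 : Σ (ℕ → ℕ) λ a →
                 ((n : ℕ) → 1 ≤ n → NumberOf n Counted (a n))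
                 × a 1 ≡ 1 × a 2 ≡ 2 × a 3 ≡ 5
                 × ((n : ℕ) → 4 ≤ n →
                      + a n ≡ (+ 3) * (+ a (n ∸ 1)) - (+ 2) * (+ a (n ∸ 2)) + (+ a (n ∸ 3)))
mainTheorem7 =
  #Good , (λ n _ → numberOf-fromLists counted⇔good (numberOfLists-good n)) , refl , refl , refl , recurrence
  where
  recurrence : (n : ℕ) → 4 ≤ n →
               + #Good n ≡ + 3 * + #Good (n ∸ 1) - + 2 * + #Good (n ∸ 2) + + #Good (n ∸ 3)
  recurrence (suc (suc (suc n))) _ =
    ℕ-identity⇒ℤ-identity (#Good (3 ℕ.+ n)) (#Good (1 ℕ.+ n)) (#Good (2 ℕ.+ n)) (#Good n) 2 3
      (#Good-recurrence n)
  recurrence (suc (suc zero)) (s≤s (s≤s ()))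
  recurrence (suc zero)       (s≤s ())
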